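{- Let $(\mathcal{C},T,C,\succeq)$ be a target–context category, let $s$ and $s'$ be simulators with programs $P$ and $P'$ respectively, and let $(r,q)\colon s\to s'$ be a simulator morphism. Then $r$ is a lax reduction from $s$ to $s'$, i.e. $s\circ(r\otimes\mathrm{id}_C)\succeq s'$.
   Context: A gs-monoidal category is a symmetric monoidal category (tensor $\otimes$, unit $I$) whose objects carry commutative comonoids $\mathrm{copy}_A\colon A\to A\otimes A$, $\mathrm{del}_A\colon A\to I$ compatible with $\otimes$, with $\mathrm{del}_I=\mathrm{id}_I$. For $f\colon A\to X$: $\mathrm{dom}(f)=(\mathrm{id}_A\otimes(\mathrm{del}_X\circ f))\circ\mathrm{copy}_A$; normalized: $f\circ\mathrm{dom}(f)=f$; functional: $\mathrm{copy}_X\circ f=(f\otimes f)\circ\mathrm{copy}_A$. A target–context category $(\mathcal{C},T,C,\succeq)$ is a gs-monoidal category with all morphisms normalized, objects $T,C$ and a preorder $\succeq$ on each $\mathcal{C}(A,T\otimes C)$ with $f\circ\mathrm{dom}(g)=g\Rightarrow f\succeq g$ and $f\succeq g\Rightarrow f\circ h\succeq g\circ h$. A simulator with programs $P$: $s\colon P\otimes C\to T\otimes C$ such that there are a functional $s_T\colon P\to T$ and $s_C\colon P\otimes C\to C$ with $s=(s_T\otimes s_C)\circ(\mathrm{copy}_P\otimes\mathrm{id}_C)$, $(\mathrm{id}_T\otimes\mathrm{del}_C)\circ s=s_T\otimes\mathrm{del}_C$, $(\mathrm{del}_T\otimes\mathrm{id}_C)\circ s=s_C$. A simulator morphism $(r,q)\colon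 s\to s'$ consists of a functional $r\colon P'\to P$ and $q\colon P'\otimes T\otimes C\to T\otimes C$ such that (i) $q$ is a simulator with programs $P'\otimes T$; (ii) $\mathrm{del}_{P'}\otimes\mathrm{id}_{T\otimes C}\succeq q$; (iii) $s'=q\circ(\mathrm{id}_{P'}\otimes(s\circ(r\otimes\mathrm{id}_C)))\circ(\mathrm{copy}_{P'}\otimes\mathrm{id}_C)$. -}

module Defs where

open import Level using (Level; _⊔_) renaming (suc to lsuc)
open import Relation.Binary.PropositionalEquality using (_≡_)

record GSMonoidal (o ℓ : Level) : Set (lsuc (o ⊔ ℓ)) where
  infixr 9 _∘_
  infixr 10 _⊗₀_ _⊗₁_
  field
    Obj : Set o
    _⇒_ : Obj → Obj → Set ℓ
    id  : ∀ {A} → A ⇒ A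
    _∘_ : ∀ {A B X} → B ⇒ X → A ⇒ B → A ⇒ X
    identityˡ : ∀ {A B} (f : A ⇒ B) → id ∘ f ≡ f
    identityʳ : ∀ {A B} (f : A ⇒ B) → f ∘ id ≡ f
    assoc : ∀ {A B X Y} (h : X ⇒ Y) (g : B ⇒ X) (f : A ⇒ B) →
            (h ∘ g) ∘ f ≡ h ∘ (g ∘ f)

    _⊗₀_ : Obj → Obj → Obj
    I    : Obj
    _⊗₁_ : ∀ {A B X Y} → A ⇒ X → B ⇒ Y → (A ⊗₀ B) ⇒ (X ⊗₀ Y)
    ⊗-id : ∀ {A B} → id {A} ⊗₁ id {B} ≡ id
    ⊗-∘  : ∀ {A B X Y Z W} (f : X ⇒ Z) (g : A ⇒ X) (h : Y ⇒ W) (k : B ⇒ Y) →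
           (f ∘ g) ⊗₁ (h ∘ k) ≡ (f ⊗₁ h) ∘ (g ⊗₁ k)

    α   : ∀ {A B X} → ((A ⊗₀ B) ⊗₀ X) ⇒ (A ⊗₀ (B ⊗₀ X))
    α⁻¹ : ∀ {A B X} → (A ⊗₀ (B ⊗₀ X)) ⇒ ((A ⊗₀ B) ⊗₀ X)
    α-isoˡ : ∀ {A B X} → α⁻¹ ∘ α {A} {B} {X} ≡ id
    α-isoʳ : ∀ {A B X} → α ∘ α⁻¹ {A} {B} {X} ≡ id
    α-natural : ∀ {A B X A' B' X'} (f : A ⇒ A') (g : B ⇒ B') (h : X ⇒ X') →
                α ∘ ((f ⊗₁ g) ⊗₁ h) ≡ (f ⊗₁ (g ⊗₁ h)) ∘ α
    λ⇒  : ∀ {A} → (I ⊗₀ A) ⇒ A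
    λ⇐  : ∀ {A} → A ⇒ (I ⊗₀ A)
    λ-isoˡ : ∀ {A} → λ⇐ ∘ λ⇒ {A} ≡ id
    λ-isoʳ : ∀ {A} → λ⇒ ∘ λ⇐ {A} ≡ id
    λ-natural : ∀ {A B} (f : A ⇒ B) → λ⇒ ∘ (id ⊗₁ f) ≡ f ∘ λ⇒
    ρ⇒  : ∀ {A} → (A ⊗₀ I) ⇒ A
    ρ⇐  : ∀ {A} → A ⇒ (A ⊗₀ I)
    ρ-isoˡ : ∀ {A} → ρ⇐ ∘ ρ⇒ {A} ≡ id
    ρ-isoʳ : ∀ {A} → ρ⇒ ∘ ρ⇐ {A} ≡ id
    ρ-natural : ∀ {A B} (f : A ⇒ B) → ρ⇒ ∘ (f ⊗₁ id) ≡ f ∘ ρ⇒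
    σ   : ∀ {A B} → (A ⊗₀ B) ⇒ (B ⊗₀ A)
    σ-natural : ∀ {A B X Y} (f : A ⇒ X) (g : B ⇒ Y) →
                σ ∘ (f ⊗₁ g) ≡ (g ⊗₁ f) ∘ σ
    σ-involutive : ∀ {A B} → σ {B} {A} ∘ σ {A} {B} ≡ id
    pentagon : ∀ {A B X Y} →
      (id {A} ⊗₁ α {B} {X} {Y}) ∘ α ∘ (α ⊗₁ id) ≡ α ∘ α
    triangle : ∀ {A B} →
      (id {A} ⊗₁ λ⇒ {B}) ∘ α ≡ ρ⇒ ⊗₁ id
    -- (redundant: derivable from pentagon+triangle, Kelly 1964)
    λ-α : ∀ {A B} → λ⇒ {A ⊗₀ B} ∘ α ≡ λ⇒ ⊗₁ id
    hexagon : ∀ {A B X} →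
      (id {B} ⊗₁ σ {A} {X}) ∘ α ∘ (σ ⊗₁ id) ≡ α ∘ σ ∘ α

  interchange : ∀ {A B X Y} → ((A ⊗₀ B) ⊗₀ (X ⊗₀ Y)) ⇒ ((A ⊗₀ X) ⊗₀ (B ⊗₀ Y))
  interchange = α ∘ ((α⁻¹ ∘ (id ⊗₁ σ) ∘ α) ⊗₁ id) ∘ α⁻¹

  field
    copy : ∀ {A} → A ⇒ (A ⊗₀ A)
    del  : ∀ {A} → A ⇒ I
    counitˡ : ∀ {A} → λ⇒ ∘ (del ⊗₁ id) ∘ copy {A} ≡ id
    counitʳ : ∀ {A} → ρ⇒ ∘ (id ⊗₁ del) ∘ copy {A} ≡ id
    coassoc : ∀ {A} → α ∘ (copy ⊗₁ id) ∘ copy {A} ≡ (id ⊗₁ copy) ∘ copy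
    cocomm  : ∀ {A} → σ ∘ copy {A} ≡ copy
    copy-⊗ : ∀ {A B} → copy {A ⊗₀ B} ≡ interchange ∘ (copy {A} ⊗₁ copy {B})
    del-⊗  : ∀ {A B} → del {A ⊗₀ B} ≡ λ⇒ ∘ (del {A} ⊗₁ del {B})
    copy-I : copy {I} ≡ λ⇐
    del-I  : del {I} ≡ id

  dom : ∀ {A X} → A ⇒ X → A ⇒ A
  dom f = ρ⇒ ∘ (id ⊗₁ (del ∘ f)) ∘ copy

  Normalized : ∀ {A X} → A ⇒ X → Set ℓ
  Normalized f = f ∘ dom f ≡ f

  Functional : ∀ {A X} → A ⇒ X → Set ℓ
  Functional {A} {X} f = copy {X} ∘ f ≡ (f ⊗₁ f) ∘ copy {A}

record TargetContext (o ℓ p : Level) : Set (lsuc (o ⊔ ℓ ⊔ p)) where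
  field
    gs : GSMonoidal o ℓ
  open GSMonoidal gs
  field
    normalized : ∀ {A X} (f : A ⇒ X) → Normalized f
    T C : Obj
    _⪰_ : ∀ {A} → A ⇒ (T ⊗₀ C) → A ⇒ (T ⊗₀ C) → Set p
    ⪰-refl  : ∀ {A} {f : A ⇒ (T ⊗₀ C)} → f ⪰ f
    ⪰-trans : ∀ {A} {f g h : A ⇒ (T ⊗₀ C)} → f ⪰ g → g ⪰ h → f ⪰ h
    ⪰-dom   : ∀ {A} {f g : A ⇒ (T ⊗₀ C)} → f ∘ dom g ≡ g → f ⪰ g
    ⪰-∘     : ∀ {A B} {f g : B ⇒ (T ⊗₀ C)} (h : A ⇒ B) → f ⪰ g → (f ∘ h) ⪰ (g ∘ h)

module TC {o ℓ p} (𝒞 : TargetContext o ℓ p) where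
  open TargetContext 𝒞 public
  open GSMonoidal gs public

  record IsSimulator (P : Obj) (s : (P ⊗₀ C) ⇒ (T ⊗₀ C)) : Set ℓ where
    field
      sT : P ⇒ T
      sC : (P ⊗₀ C) ⇒ C
      sT-functional : Functional sT
      decomp  : s ≡ (sT ⊗₁ sC) ∘ α ∘ (copy {P} ⊗₁ id {C})
      proj-T  : (id {T} ⊗₁ del {C}) ∘ s ≡ sT ⊗₁ del {C}
      proj-C  : λ⇒ ∘ (del {T} ⊗₁ id {C}) ∘ s ≡ sC

  record IsSimulatorMorphism {P P' : Obj}
      (s : (P ⊗₀ C) ⇒ (T ⊗₀ C)) (s' : (P' ⊗₀ C) ⇒ (T ⊗₀ C))
      (r : P' ⇒ P) (q : ((P' ⊗₀ T) ⊗₀ C) ⇒ (T ⊗₀ C)) : Set (ℓ ⊔ p) where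
    field
      r-functional : Functional r
      q-simulator  : IsSimulator (P' ⊗₀ T) q
      q-lax        : (λ⇒ ∘ (del {P'} ⊗₁ id {T ⊗₀ C}) ∘ α) ⪰ q
      s'-eq        : s' ≡ q ∘ α⁻¹ ∘ (id {P'} ⊗₁ (s ∘ (r ⊗₁ id {C}))) ∘ α ∘ (copy {P'} ⊗₁ id {C})

  LaxReduction : {P P' : Obj} (s : (P ⊗₀ C) ⇒ (T ⊗₀ C)) (s' : (P' ⊗₀ C) ⇒ (T ⊗₀ C))
                 (r : P' ⇒ P) → Set p
  LaxReduction s s' r = (s ∘ (r ⊗₁ id {C})) ⪰ s'

-- The lax bound on q says that q is dominated by the map that forgets its
-- program input P'.  Preordering is stable under precomposition, so
-- precomposing with the map that feeds q in the decomposition of s' gives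
-- "forget P'" ∘ (copy P', run s ∘ (r ⊗ id) on one copy) ⪰ s'; by the counit law
-- the left-hand side is s ∘ (r ⊗ id).
module Submission where

open import Level using (Level)
open import Defs
open import Relation.Binary.PropositionalEquality

module GSMonoidalProperties {o ℓ} (𝒢 : GSMonoidal o ℓ) where
  open GSMonoidal 𝒢
  open ≡-Reasoning

  pullˡ : ∀ {A B X Y} {f : X ⇒ Y} {g : B ⇒ X} {h : B ⇒ Y} {k : A ⇒ B} →
          f ∘ g ≡ h → f ∘ g ∘ k ≡ h ∘ k
  pullˡ {f = f} {g} {k = k} fg≡h = trans (sym (assoc f g k)) (cong (_∘ k) fg≡h)

  ⊗-exchange : ∀ {A B X Y} (f : A ⇒ X) (g : B ⇒ Y) →
               (f ⊗₁ id) ∘ (id ⊗₁ g) ≡ (id ⊗₁ g) ∘ (f ⊗₁ id)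
  ⊗-exchange f g = begin
    (f ⊗₁ id) ∘ (id ⊗₁ g)   ≡⟨ sym (⊗-∘ f id id g) ⟩
    (f ∘ id) ⊗₁ (id ∘ g)    ≡⟨ cong₂ _⊗₁_ (trans (identityʳ f) (sym (identityˡ f)))
                                          (trans (identityˡ g) (sym (identityʳ g))) ⟩
    (id ∘ f) ⊗₁ (g ∘ id)    ≡⟨ ⊗-∘ id f g id ⟩
    (id ⊗₁ g) ∘ (f ⊗₁ id)   ∎

  discardˡ : ∀ {A B} → (A ⊗₀ B) ⇒ B
  discardˡ = λ⇒ ∘ (del ⊗₁ id)

  discardˡ-natural : ∀ {A B Y} (g : B ⇒ Y) →
                     discardˡ {A} ∘ (id ⊗₁ g) ≡ g ∘ discardˡ
  discardˡ-natural g = begin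
    (λ⇒ ∘ (del ⊗₁ id)) ∘ (id ⊗₁ g)   ≡⟨ assoc λ⇒ _ _ ⟩
    λ⇒ ∘ (del ⊗₁ id) ∘ (id ⊗₁ g)     ≡⟨ cong (λ⇒ ∘_) (⊗-exchange del g) ⟩
    λ⇒ ∘ (id ⊗₁ g) ∘ (del ⊗₁ id)     ≡⟨ pullˡ (λ-natural g) ⟩
    (g ∘ λ⇒) ∘ (del ⊗₁ id)           ≡⟨ assoc g λ⇒ _ ⟩
    g ∘ λ⇒ ∘ (del ⊗₁ id)             ∎

  discardˡ-α : ∀ {A B X} → discardˡ {A} {B ⊗₀ X} ∘ α ≡ discardˡ ⊗₁ id
  discardˡ-α = begin
    (λ⇒ ∘ (del ⊗₁ id)) ∘ α               ≡⟨ assoc λ⇒ _ α ⟩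
    λ⇒ ∘ (del ⊗₁ id) ∘ α                 ≡⟨ cong (λ i → λ⇒ ∘ (del ⊗₁ i) ∘ α) (sym ⊗-id) ⟩
    λ⇒ ∘ (del ⊗₁ (id ⊗₁ id)) ∘ α         ≡⟨ cong (λ⇒ ∘_) (sym (α-natural del id id)) ⟩
    λ⇒ ∘ α ∘ ((del ⊗₁ id) ⊗₁ id)         ≡⟨ pullˡ λ-α ⟩
    (λ⇒ ⊗₁ id) ∘ ((del ⊗₁ id) ⊗₁ id)     ≡⟨ sym (⊗-∘ λ⇒ _ id id) ⟩
    (λ⇒ ∘ (del ⊗₁ id)) ⊗₁ (id ∘ id)      ≡⟨ cong (discardˡ ⊗₁_) (identityˡ id) ⟩
    discardˡ ⊗₁ id                       ∎

  discardˡ-copy : ∀ {A} → discardˡ ∘ copy {A} ≡ id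
  discardˡ-copy = trans (assoc λ⇒ _ copy) counitˡ

  -- Runs g on A ⊗ X while keeping a copy of the A input on the left; this is
  -- how s' is assembled from q and s ∘ (r ⊗ id).
  retainˡ : ∀ {A X B Y} → (A ⊗₀ X) ⇒ (B ⊗₀ Y) → (A ⊗₀ X) ⇒ ((A ⊗₀ B) ⊗₀ Y)
  retainˡ g = α⁻¹ ∘ (id ⊗₁ g) ∘ α ∘ (copy ⊗₁ id)

  discardˡ-retainˡ : ∀ {A X B Y} (g : (A ⊗₀ X) ⇒ (B ⊗₀ Y)) →
                     (λ⇒ ∘ (del {A} ⊗₁ id) ∘ α) ∘ retainˡ g ≡ g
  discardˡ-retainˡ g = begin
    (λ⇒ ∘ (del ⊗₁ id) ∘ α) ∘ retainˡ g
      ≡⟨ cong (_∘ retainˡ g) (sym (assoc λ⇒ _ α)) ⟩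
    (discardˡ ∘ α) ∘ α⁻¹ ∘ (id ⊗₁ g) ∘ α ∘ (copy ⊗₁ id)
      ≡⟨ assoc discardˡ α _ ⟩
    discardˡ ∘ α ∘ α⁻¹ ∘ (id ⊗₁ g) ∘ α ∘ (copy ⊗₁ id)
      ≡⟨ cong (discardˡ ∘_) (pullˡ α-isoʳ) ⟩
    discardˡ ∘ id ∘ (id ⊗₁ g) ∘ α ∘ (copy ⊗₁ id)
      ≡⟨ cong (discardˡ ∘_) (identityˡ _) ⟩
    discardˡ ∘ (id ⊗₁ g) ∘ α ∘ (copy ⊗₁ id)
      ≡⟨ pullˡ (discardˡ-natural g) ⟩
    (g ∘ discardˡ) ∘ α ∘ (copy ⊗₁ id)
      ≡⟨ assoc g discardˡ _ ⟩
    g ∘ discardˡ ∘ α ∘ (copy ⊗₁ id)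
      ≡⟨ cong (g ∘_) (pullˡ discardˡ-α) ⟩
    g ∘ (discardˡ ⊗₁ id) ∘ (copy ⊗₁ id)
      ≡⟨ cong (g ∘_) (sym (⊗-∘ discardˡ copy id id)) ⟩
    g ∘ ((discardˡ ∘ copy) ⊗₁ (id ∘ id))
      ≡⟨ cong (g ∘_) (cong₂ _⊗₁_ discardˡ-copy (identityˡ id)) ⟩
    g ∘ (id ⊗₁ id)
      ≡⟨ cong (g ∘_) ⊗-id ⟩
    g ∘ id
      ≡⟨ identityʳ g ⟩
    g ∎

mainTheorem11 : ∀ {o ℓ p : Level} (𝒞 : TargetContext o ℓ p) →
    let open TC 𝒞 in
    ∀ {P P' : Obj}
    (s : (P ⊗₀ C) ⇒ (T ⊗₀ C)) (s' : (P' ⊗₀ C) ⇒ (T ⊗₀ C)) →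
    IsSimulator P s → IsSimulator P' s' →
    (r : P' ⇒ P) (q : ((P' ⊗₀ T) ⊗₀ C) ⇒ (T ⊗₀ C)) →
    IsSimulatorMorphism s s' r q →
    LaxReduction s s' r
mainTheorem11 𝒞 {P' = P'} s s' _ _ r q morphism =
  subst₂ _⪰_ (discardˡ-retainˡ reduced) (sym s'-eq) (⪰-∘ (retainˡ reduced) q-lax)
  where
    open TC 𝒞
    open GSMonoidalProperties gs
    open IsSimulatorMorphism morphism

    reduced : (P' ⊗₀ C) ⇒ (T ⊗₀ C)
    reduced = s ∘ (r ⊗₁ id)
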